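{- For every melon graph $G$, $\mathrm{alt}(G)\le 1$. Conversely, for every series-parallel graph $G$ with $\mathrm{alt}(G)\le 1$, either $G$ is a $k$-melon graph for some $k\ge1$, or $G$ is a path in which edges may be multiple.
   Context: Graphs may have multiple edges. Series-parallel graphs have two distinguished vertices (source $s$, sink $t$) and are defined recursively: a single edge is series-parallel; the series composition of $G_1,G_2$ identifies $t_1$ with $s_2$ (new source $s_1$, new sink $t_2$); the parallel composition identifies $s_1$ with $s_2$ (new source) and $t_1$ with $t_2$ (new sink). An SP-decomposition tree of a series-parallel graph $G$ is a rooted binary tree whose leaves correspond to the edges of $G$ and whose internal nodes are labeled series or parallel, such that the graph associated with an internal node is the composition (of the indicated type) of the graphs associated with its two children, and $G$ is associated with the root. $\mathrm{alt}(G)$ is the maximum, over all SP-decomposition trees of $G$ and all root-to-leaf paths in them, of the number of alternations between parallel and series nodes (i.e. consecutive internal nodes on the path with different labels). For $k\ge1$, a $k$-melon graph is the parallel composition of $k$ pairwise internally vertex-disjoint paths with the same distinct endpoints $s,t$; a melon graph is a $k$-melon graph for some $k$. -}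

module Defs where

open import Data.Nat using (ℕ; zero; suc; _≤_; _⊔_; _+_)
open import Data.Fin using (Fin; inject₁; fromℕ)
open import Data.Product using (Σ; ∃; _×_; _,_; proj₁; proj₂)
open import Data.Sum using (_⊎_; inj₁; inj₂)
open import Relation.Binary.PropositionalEquality using (_≡_; _≢_)
open import Function.Bundles using (_↔_; Inverse)
open import Function.Definitions using (Injective)

-- Finite two-terminal multigraphs.
-- Vertices are Fin nV, edges are Fin nE; each edge has an (unordered)
-- pair of endpoints, stored as an ordered pair and compared up to swap.

record TTG : Set where
  field
    nV   : ℕ
    nE   : ℕ
    ends : Fin nE → Fin nV × Fin nV
    src  : Fin nV
    snk  : Fin nV
open TTG public

SameEdge : ∀ {n} → Fin n × Fin n → Fin n × Fin n → Set
SameEdge (a , b) (c , d) = (a ≡ c × b ≡ d) ⊎ (a ≡ d × b ≡ c)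

mapPair : ∀ {n m} → (Fin n → Fin m) → Fin n × Fin n → Fin m × Fin m
mapPair f (a , b) = f a , f b

IsSingleEdge : TTG → Set
IsSingleEdge G =
  (src G ≢ snk G) × (nE G ≡ 1) ×
  (∀ v → v ≡ src G ⊎ v ≡ snk G) ×
  (∀ e → SameEdge (ends G e) (src G , snk G))

-- G is (isomorphic to) the disjoint union of G₁ and G₂ glued along the
-- vertex maps f₁, f₂ (injective, jointly surjective), the edges of G
-- being exactly the images of the edges of G₁ and of G₂.
record Glue (G₁ G₂ G : TTG) : Set where
  field
    f₁    : Fin (nV G₁) → Fin (nV G)
    f₂    : Fin (nV G₂) → Fin (nV G)
    inj₁f : Injective _≡_ _≡_ f₁
    inj₂f : Injective _≡_ _≡_ f₂
    cover : ∀ v → (∃ λ u → f₁ u ≡ v) ⊎ (∃ λ u → f₂ u ≡ v)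
    edges : (Fin (nE G₁) ⊎ Fin (nE G₂)) ↔ Fin (nE G)
    edges₁ : ∀ e → SameEdge (ends G (Inverse.to edges (inj₁ e))) (mapPair f₁ (ends G₁ e))
    edges₂ : ∀ e → SameEdge (ends G (Inverse.to edges (inj₂ e))) (mapPair f₂ (ends G₂ e))

record SeriesComp (G₁ G₂ G : TTG) : Set where
  field
    glue : Glue G₁ G₂ G
    meet : ∀ u₁ u₂ → Glue.f₁ glue u₁ ≡ Glue.f₂ glue u₂ → u₁ ≡ snk G₁ × u₂ ≡ src G₂
    joint   : Glue.f₁ glue (snk G₁) ≡ Glue.f₂ glue (src G₂)
    newSrc  : src G ≡ Glue.f₁ glue (src G₁)
    newSnk  : snk G ≡ Glue.f₂ glue (snk G₂)

record ParallelComp (G₁ G₂ G : TTG) : Set where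
  field
    glue : Glue G₁ G₂ G
    meet : ∀ u₁ u₂ → Glue.f₁ glue u₁ ≡ Glue.f₂ glue u₂ →
              (u₁ ≡ src G₁ × u₂ ≡ src G₂) ⊎ (u₁ ≡ snk G₁ × u₂ ≡ snk G₂)
    srcs : Glue.f₁ glue (src G₁) ≡ src G × Glue.f₂ glue (src G₂) ≡ src G
    snks : Glue.f₁ glue (snk G₁) ≡ snk G × Glue.f₂ glue (snk G₂) ≡ snk G

data Label : Set where
  S P : Label

data SPTree : Set where
  leaf : SPTree
  node : Label → SPTree → SPTree → SPTree

data Decomp : SPTree → TTG → Set where
  leafD : ∀ {G} → IsSingleEdge G → Decomp leaf G
  serD  : ∀ {T₁ T₂ G₁ G₂ G} → Decomp T₁ G₁ → Decomp T₂ G₂ →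
          SeriesComp G₁ G₂ G → Decomp (node S T₁ T₂) G
  parD  : ∀ {T₁ T₂ G₁ G₂ G} → Decomp T₁ G₁ → Decomp T₂ G₂ →
          ParallelComp G₁ G₂ G → Decomp (node P T₁ T₂) G

IsSeriesParallel : TTG → Set
IsSeriesParallel G = ∃ λ T → Decomp T G

change : Label → SPTree → ℕ
change ℓ leaf = 0
change S (node S _ _) = 0
change S (node P _ _) = 1
change P (node S _ _) = 1
change P (node P _ _) = 0

alts : SPTree → ℕ
alts leaf = 0
alts (node ℓ l r) = (alts l + change ℓ l) ⊔ (alts r + change ℓ r)

-- alt(G) ≤ k  (alt(G) is the maximum of alts T over decomposition trees T of G)
AltAtMost : ℕ → TTG → Set
AltAtMost k G = ∀ T → Decomp T G → alts T ≤ k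

-- Melon graphs: parallel composition of k pairwise internally
-- vertex-disjoint s–t paths, s ≠ t being the terminals of G.

record IsKMelon (k : ℕ) (G : TTG) : Set where
  field
    distinct : src G ≢ snk G
    len      : Fin k → ℕ
    len≥1    : ∀ i → 1 ≤ len i
    path     : (i : Fin k) → Fin (suc (len i)) → Fin (nV G)
    pathInj  : ∀ i → Injective _≡_ _≡_ (path i)
    start    : ∀ i → path i Data.Fin.zero ≡ src G
    end      : ∀ i → path i (fromℕ (len i)) ≡ snk G
    disjoint : ∀ i j a b → path i a ≡ path j b →
               i ≡ j ⊎ (path i a ≡ src G ⊎ path i a ≡ snk G)
    cover    : ∀ v → ∃ λ i → ∃ λ a → path i a ≡ v
    edges    : (Σ (Fin k) λ i → Fin (len i)) ↔ Fin (nE G)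
    edgeEnds : ∀ i a → SameEdge (ends G (Inverse.to edges (i , a)))
                                (path i (inject₁ a) , path i (Data.Fin.suc a))

IsMelon : TTG → Set
IsMelon G = ∃ λ k → IsKMelon k G

record IsMultiPath (G : TTG) : Set where
  field
    len      : ℕ
    vert     : Fin (suc len) → Fin (nV G)
    vertInj  : Injective _≡_ _≡_ vert
    vertSurj : ∀ v → ∃ λ a → vert a ≡ v
    edgeOn   : ∀ e → ∃ λ (a : Fin len) →
               SameEdge (ends G e) (vert (inject₁ a) , vert (Data.Fin.suc a))
    stepHasEdge : ∀ (a : Fin len) → ∃ λ e →
               SameEdge (ends G e) (vert (inject₁ a) , vert (Data.Fin.suc a))

{-# OPTIONS --safe #-}
module Submission where

-- A decomposition tree has at most one alternation iff it is layered: compositions of one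
-- kind applied to blocks that use only the other kind.  Putting a parallel subgraph in
-- series makes one of its terminals internal, where it meets two parallel edges and an
-- edge of the other side; such a branch vertex survives every later composition.  A melon
-- has none, since an internal vertex lies on one strand and meets one step on each side,
-- so all its decomposition trees are layered with parallel on top.  Conversely, a layered
-- tree with series on top puts dipoles (bundles of parallel edges) in series, giving a path
-- with multiple edges, and one with parallel on top puts simple paths in parallel, giving a
-- melon.

open import Defs
open import Data.Nat using (ℕ; _≤_)
open import Data.Product using (∃; _×_)
open import Data.Sum using (_⊎_)

open import Data.Nat using (zero; suc; _+_; _⊔_; z≤n)
open import Data.Nat.Properties
  using (≤-refl; ≤-trans; m≤m+n; +-identityʳ; +-cancelʳ-≤; ⊔-lub;
         m⊔n≤o⇒m≤o; m⊔n≤o⇒n≤o; m+n≤o⇒m≤o; m+n≤o⇒n≤o; n≢0⇒n>0)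
open import Data.Fin using (Fin; zero; suc; inject₁; fromℕ; splitAt; join; _↑ˡ_; _↑ʳ_)
open import Data.Fin.Properties
  using (suc-injective; inject₁-injective; splitAt⁻¹-↑ˡ; splitAt⁻¹-↑ʳ; splitAt-join; +↔⊎)
open import Data.Product using (Σ; ∃₂; _,_; proj₁; proj₂)
open import Data.Sum using (inj₁; inj₂; [_,_]′)
import Data.Sum as Sum
open import Data.Sum.Properties using (inj₁-injective; inj₂-injective)
open import Data.Sum.Function.Propositional using (_⊎-↔_)
open import Data.Product.Function.Dependent.Propositional using (Σ-↔)
open import Data.Empty using (⊥; ⊥-elim)
open import Function using (_∘_)
open import Function.Bundles using (_↔_; Inverse; Injection; mk↔ₛ′)
open import Function.Definitions using (Injective)
open import Function.Properties.Inverse using (↔-refl; ↔-sym; ↔-trans; ↔⇒↣)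
open import Function.Related.TypeIsomorphisms using (Σ-distribʳ-⊎)
open import Relation.Nullary using (¬_; contradiction)
open import Relation.Binary.PropositionalEquality
  using (_≡_; _≢_; refl; sym; trans; cong; cong₂; subst)

to-injective : ∀ {A B : Set} (I : A ↔ B) → Injective _≡_ _≡_ (Inverse.to I)
to-injective I = Injection.injective (↔⇒↣ I)

from-injective : ∀ {A B : Set} (I : A ↔ B) → Injective _≡_ _≡_ (Inverse.from I)
from-injective I = to-injective (↔-sym I)

⊎-map-injective : ∀ {A B C D : Set} {f : A → C} {g : B → D} →
                  Injective _≡_ _≡_ f → Injective _≡_ _≡_ g → Injective _≡_ _≡_ (Sum.map f g)
⊎-map-injective f-inj g-inj {inj₁ x} {inj₁ y} eq = cong inj₁ (f-inj (inj₁-injective eq))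
⊎-map-injective f-inj g-inj {inj₂ x} {inj₂ y} eq = cong inj₂ (g-inj (inj₂-injective eq))

↑-view : ∀ m n (a : Fin (m + n)) → (∃ λ b → b ↑ˡ n ≡ a) ⊎ (∃ λ c → m ↑ʳ c ≡ a)
↑-view m n a with splitAt m a in eq
... | inj₁ b = inj₁ (b , splitAt⁻¹-↑ˡ eq)
... | inj₂ c = inj₂ (c , splitAt⁻¹-↑ʳ eq)

Terminal : (H : TTG) → Fin (nV H) → Set
Terminal H v = v ≡ src H ⊎ v ≡ snk H

Internal : (H : TTG) → Fin (nV H) → Set
Internal H v = v ≢ src H × v ≢ snk H

_∈ᵉ_ : ∀ {n} → Fin n → Fin n × Fin n → Set
v ∈ᵉ (a , b) = a ≡ v ⊎ b ≡ v

Incident : (H : TTG) → Fin (nE H) → Fin (nV H) → Set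
Incident H e v = v ∈ᵉ ends H e

EdgeAt : (H : TTG) → Fin (nV H) → Set
EdgeAt H v = ∃ λ e → Incident H e v

TwoEdgesAt : (H : TTG) → Fin (nV H) → Set
TwoEdgesAt H v = ∃₂ λ e e′ → e ≢ e′ × Incident H e v × Incident H e′ v

module _ {n : ℕ} where

  SameEdge-sym : {p q : Fin n × Fin n} → SameEdge p q → SameEdge q p
  SameEdge-sym (inj₁ (a , b)) = inj₁ (sym a , sym b)
  SameEdge-sym (inj₂ (a , b)) = inj₂ (sym b , sym a)

  SameEdge-trans : {p q r : Fin n × Fin n} → SameEdge p q → SameEdge q r → SameEdge p r
  SameEdge-trans (inj₁ (a , b)) (inj₁ (c , d)) = inj₁ (trans a c , trans b d)
  SameEdge-trans (inj₁ (a , b)) (inj₂ (c , d)) = inj₂ (trans a c , trans b d)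
  SameEdge-trans (inj₂ (a , b)) (inj₁ (c , d)) = inj₂ (trans a d , trans b c)
  SameEdge-trans (inj₂ (a , b)) (inj₂ (c , d)) = inj₁ (trans a d , trans b c)

  SameEdge-≡ : ∀ {p : Fin n × Fin n} {a b a′ b′ : Fin n} →
               SameEdge p (a , b) → a ≡ a′ → b ≡ b′ → SameEdge p (a′ , b′)
  SameEdge-≡ same refl refl = same

  ∈ᵉ-resp-SameEdge : ∀ {p q : Fin n × Fin n} {v : Fin n} → SameEdge p q → v ∈ᵉ q → v ∈ᵉ p
  ∈ᵉ-resp-SameEdge (inj₁ (a , b)) (inj₁ c) = inj₁ (trans a c)
  ∈ᵉ-resp-SameEdge (inj₁ (a , b)) (inj₂ c) = inj₂ (trans b c)
  ∈ᵉ-resp-SameEdge (inj₂ (a , b)) (inj₁ c) = inj₂ (trans b c)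
  ∈ᵉ-resp-SameEdge (inj₂ (a , b)) (inj₂ c) = inj₁ (trans a c)

SameEdge-map : ∀ {n m} (f : Fin n → Fin m) {p q : Fin n × Fin n} →
               SameEdge p q → SameEdge (mapPair f p) (mapPair f q)
SameEdge-map f (inj₁ (a , b)) = inj₁ (cong f a , cong f b)
SameEdge-map f (inj₂ (a , b)) = inj₂ (cong f a , cong f b)

∈ᵉ-map : ∀ {n m} (f : Fin n → Fin m) {p : Fin n × Fin n} {v : Fin n} → v ∈ᵉ p → f v ∈ᵉ mapPair f p
∈ᵉ-map f (inj₁ a) = inj₁ (cong f a)
∈ᵉ-map f (inj₂ b) = inj₂ (cong f b)

record Embedding (H H′ : TTG) : Set where
  field
    vmap           : Fin (nV H) → Fin (nV H′)
    vmap-injective : Injective _≡_ _≡_ vmap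
    emap           : Fin (nE H) → Fin (nE H′)
    emap-injective : Injective _≡_ _≡_ emap
    emap-ends      : ∀ e → SameEdge (ends H′ (emap e)) (mapPair vmap (ends H e))

  emap-SameEdge : ∀ {e q} → SameEdge (ends H e) q → SameEdge (ends H′ (emap e)) (mapPair vmap q)
  emap-SameEdge {e} same = SameEdge-trans (emap-ends e) (SameEdge-map vmap same)

  emap-Incident : ∀ {e v} → Incident H e v → Incident H′ (emap e) (vmap v)
  emap-Incident {e} i = ∈ᵉ-resp-SameEdge (emap-ends e) (∈ᵉ-map vmap i)

  emap-EdgeAt : ∀ {v} → EdgeAt H v → EdgeAt H′ (vmap v)
  emap-EdgeAt (e , i) = emap e , emap-Incident i

open Embedding using (vmap; emap; emap-SameEdge; emap-Incident; emap-EdgeAt)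

record BranchVertex (H : TTG) : Set where
  field
    vertex   : Fin (nV H)
    internal : Internal H vertex
    e₁ e₂ e₃ : Fin (nE H)
    e₁≢e₂    : e₁ ≢ e₂
    e₁≢e₃    : e₁ ≢ e₃
    e₂≢e₃    : e₂ ≢ e₃
    at₁      : Incident H e₁ vertex
    at₂      : Incident H e₂ vertex
    at₃      : Incident H e₃ vertex

branchVertex-embed : ∀ {H H′} (ι : Embedding H H′) →
                     (∀ {v} → Internal H v → Internal H′ (vmap ι v)) →
                     BranchVertex H → BranchVertex H′
branchVertex-embed ι internal′ b = record
  { vertex = vmap ι vertex ; internal = internal′ internal
  ; e₁ = emap ι e₁ ; e₂ = emap ι e₂ ; e₃ = emap ι e₃
  ; e₁≢e₂ = e₁≢e₂ ∘ emap-injective ; e₁≢e₃ = e₁≢e₃ ∘ emap-injective ; e₂≢e₃ = e₂≢e₃ ∘ emap-injective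
  ; at₁ = emap-Incident ι at₁ ; at₂ = emap-Incident ι at₂ ; at₃ = emap-Incident ι at₃ }
  where open BranchVertex b
        open Embedding ι using (emap-injective)

module _ {G₁ G₂ G : TTG} (g : Glue G₁ G₂ G) where
  open Glue g

  embed₁ : Embedding G₁ G
  embed₁ = record
    { vmap = f₁ ; vmap-injective = inj₁f
    ; emap = λ e → Inverse.to edges (inj₁ e)
    ; emap-injective = λ eq → inj₁-injective (to-injective edges eq)
    ; emap-ends = edges₁ }

  embed₂ : Embedding G₂ G
  embed₂ = record
    { vmap = f₂ ; vmap-injective = inj₂f
    ; emap = λ e → Inverse.to edges (inj₂ e)
    ; emap-injective = λ eq → inj₂-injective (to-injective edges eq)
    ; emap-ends = edges₂ }

  embed₁≢embed₂ : ∀ e₁ e₂ → emap embed₁ e₁ ≢ emap embed₂ e₂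
  embed₁≢embed₂ e₁ e₂ eq with to-injective edges eq
  ... | ()

  edge-view : ∀ e → (∃ λ x → emap embed₁ x ≡ e) ⊎ (∃ λ x → emap embed₂ x ≡ e)
  edge-view e with Inverse.from edges e | Inverse.strictlyInverseˡ edges e
  ... | inj₁ x | eq = inj₁ (x , eq)
  ... | inj₂ x | eq = inj₂ (x , eq)

  twoEdgesAt : ∀ {x y v} → f₁ x ≡ v → f₂ y ≡ v → EdgeAt G₁ x → EdgeAt G₂ y → TwoEdgesAt G v
  twoEdgesAt refl y↦v (a , ia) (c , ic) =
    emap embed₁ a , emap embed₂ c , embed₁≢embed₂ a c ,
    emap-Incident embed₁ ia , subst (Incident G _) y↦v (emap-Incident embed₂ ic)

  branch-2+1 : ∀ {x y v} → Internal G v → f₁ x ≡ v → f₂ y ≡ v →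
               TwoEdgesAt G₁ x → EdgeAt G₂ y → BranchVertex G
  branch-2+1 int refl y↦v (a , a′ , a≢a′ , ia , ia′) (c , ic) = record
    { vertex = _ ; internal = int
    ; e₁ = emap embed₁ a ; e₂ = emap embed₁ a′ ; e₃ = emap embed₂ c
    ; e₁≢e₂ = a≢a′ ∘ Embedding.emap-injective embed₁
    ; e₁≢e₃ = embed₁≢embed₂ a c ; e₂≢e₃ = embed₁≢embed₂ a′ c
    ; at₁ = emap-Incident embed₁ ia ; at₂ = emap-Incident embed₁ ia′
    ; at₃ = subst (Incident G _) y↦v (emap-Incident embed₂ ic) }

  branch-1+2 : ∀ {x y v} → Internal G v → f₁ x ≡ v → f₂ y ≡ v →
               EdgeAt G₁ x → TwoEdgesAt G₂ y → BranchVertex G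
  branch-1+2 int x↦v refl (a , ia) (c , c′ , c≢c′ , ic , ic′) = record
    { vertex = _ ; internal = int
    ; e₁ = emap embed₂ c ; e₂ = emap embed₂ c′ ; e₃ = emap embed₁ a
    ; e₁≢e₂ = c≢c′ ∘ Embedding.emap-injective embed₂
    ; e₁≢e₃ = embed₁≢embed₂ a c ∘ sym ; e₂≢e₃ = embed₁≢embed₂ a c′ ∘ sym
    ; at₁ = emap-Incident embed₂ ic ; at₂ = emap-Incident embed₂ ic′
    ; at₃ = subst (Incident G _) x↦v (emap-Incident embed₁ ia) }

module Series {G₁ G₂ G : TTG} (s : SeriesComp G₁ G₂ G) where
  open SeriesComp s
  open Glue glue

  internal₁ : ∀ {x} → Internal G₁ x → Internal G (f₁ x)
  internal₁ (x≢s , x≢t) = (λ eq → x≢s (inj₁f (trans eq newSrc))) ,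
                          (λ eq → x≢t (proj₁ (meet _ _ (trans eq newSnk))))

  internal₂ : ∀ {x} → Internal G₂ x → Internal G (f₂ x)
  internal₂ (x≢s , x≢t) = (λ eq → x≢s (proj₂ (meet _ _ (sym (trans eq newSrc))))) ,
                          (λ eq → x≢t (inj₂f (trans eq newSnk)))

  src≢snk : src G₂ ≢ snk G₂ → src G ≢ snk G
  src≢snk s₂≢t₂ eq = s₂≢t₂ (sym (proj₂ (meet _ _ (trans (sym newSrc) (trans eq newSnk)))))

  junction-internal : src G₁ ≢ snk G₁ → src G₂ ≢ snk G₂ → Internal G (f₁ (snk G₁))
  junction-internal s₁≢t₁ s₂≢t₂ = (λ eq → s₁≢t₁ (sym (inj₁f (trans eq newSrc)))) ,
                                  (λ eq → s₂≢t₂ (inj₂f (trans (sym joint) (trans eq newSnk))))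

module Parallel {G₁ G₂ G : TTG} (p : ParallelComp G₁ G₂ G) where
  open ParallelComp p
  open Glue glue

  internal₁ : ∀ {x} → Internal G₁ x → Internal G (f₁ x)
  internal₁ (x≢s , x≢t) = (λ eq → x≢s (inj₁f (trans eq (sym (proj₁ srcs))))) ,
                          (λ eq → x≢t (inj₁f (trans eq (sym (proj₁ snks)))))

  internal₂ : ∀ {x} → Internal G₂ x → Internal G (f₂ x)
  internal₂ (x≢s , x≢t) = (λ eq → x≢s (inj₂f (trans eq (sym (proj₂ srcs))))) ,
                          (λ eq → x≢t (inj₂f (trans eq (sym (proj₂ snks)))))

  terminal₁ : ∀ {x} → Terminal G₁ x → Terminal G (f₁ x)
  terminal₁ = Sum.map (λ q → trans (cong f₁ q) (proj₁ srcs)) (λ q → trans (cong f₁ q) (proj₁ snks))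

  terminal₂ : ∀ {x} → Terminal G₂ x → Terminal G (f₂ x)
  terminal₂ = Sum.map (λ q → trans (cong f₂ q) (proj₂ srcs)) (λ q → trans (cong f₂ q) (proj₂ snks))

  src≢snk : src G₁ ≢ snk G₁ → src G ≢ snk G
  src≢snk s₁≢t₁ eq = s₁≢t₁ (inj₁f (trans (proj₁ srcs) (trans eq (sym (proj₁ snks)))))

decomp-src≢snk : ∀ {T H} → Decomp T H → src H ≢ snk H
decomp-src≢snk (leafD (src≢snk , _)) = src≢snk
decomp-src≢snk (serD _ D₂ s) = Series.src≢snk s (decomp-src≢snk D₂)
decomp-src≢snk (parD D₁ _ p) = Parallel.src≢snk p (decomp-src≢snk D₁)

decomp-edgeAtSrc : ∀ {T H} → Decomp T H → EdgeAt H (src H)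
decomp-edgeAtSnk : ∀ {T H} → Decomp T H → EdgeAt H (snk H)

decomp-edgeAtSrc (leafD (_ , nE≡1 , _ , parallel)) =
  e , ∈ᵉ-resp-SameEdge (parallel e) (inj₁ refl)
  where e = subst Fin (sym nE≡1) zero
decomp-edgeAtSrc {H = G} (serD D₁ _ s) =
  subst (EdgeAt G) (sym newSrc) (emap-EdgeAt (embed₁ glue) (decomp-edgeAtSrc D₁))
  where open SeriesComp s
decomp-edgeAtSrc {H = G} (parD D₁ _ p) =
  subst (EdgeAt G) (proj₁ srcs) (emap-EdgeAt (embed₁ glue) (decomp-edgeAtSrc D₁))
  where open ParallelComp p

decomp-edgeAtSnk (leafD (_ , nE≡1 , _ , parallel)) =
  e , ∈ᵉ-resp-SameEdge (parallel e) (inj₂ refl)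
  where e = subst Fin (sym nE≡1) zero
decomp-edgeAtSnk {H = G} (serD _ D₂ s) =
  subst (EdgeAt G) (sym newSnk) (emap-EdgeAt (embed₂ glue) (decomp-edgeAtSnk D₂))
  where open SeriesComp s
decomp-edgeAtSnk {H = G} (parD D₁ _ p) =
  subst (EdgeAt G) (proj₁ snks) (emap-EdgeAt (embed₁ glue) (decomp-edgeAtSnk D₁))
  where open ParallelComp p

-- Shapes of decomposition trees

other : Label → Label
other S = P
other P = S

data Uniform (ℓ : Label) : SPTree → Set where
  leaf : Uniform ℓ leaf
  node : ∀ {l r} → Uniform ℓ l → Uniform ℓ r → Uniform ℓ (node ℓ l r)

data Layered (ℓ : Label) : SPTree → Set where
  block : ∀ {T} → Uniform (other ℓ) T → Layered ℓ T
  node  : ∀ {l r} → Layered ℓ l → Layered ℓ r → Layered ℓ (node ℓ l r)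

data Contains (ℓ : Label) : SPTree → Set where
  here  : ∀ {l r} → Contains ℓ (node ℓ l r)
  left  : ∀ {ℓ′ l r} → Contains ℓ l → Contains ℓ (node ℓ′ l r)
  right : ∀ {ℓ′ l r} → Contains ℓ r → Contains ℓ (node ℓ′ l r)

data SeriesOverParallel : SPTree → Set where
  here  : ∀ {l r} → Contains P l ⊎ Contains P r → SeriesOverParallel (node S l r)
  left  : ∀ {ℓ l r} → SeriesOverParallel l → SeriesOverParallel (node ℓ l r)
  right : ∀ {ℓ l r} → SeriesOverParallel r → SeriesOverParallel (node ℓ l r)

data LabelView (ℓ : Label) : Label → Set where
  same    : LabelView ℓ ℓ
  flipped : LabelView ℓ (other ℓ)

label-view : ∀ ℓ ℓ′ → LabelView ℓ ℓ′
label-view S S = same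
label-view S P = flipped
label-view P S = flipped
label-view P P = same

change-same : ∀ ℓ {l r} → change ℓ (node ℓ l r) ≡ 0
change-same S = refl
change-same P = refl

change-other : ∀ ℓ {l r} → change ℓ (node (other ℓ) l r) ≡ 1
change-other S = refl
change-other P = refl

change≤1 : ∀ ℓ T → change ℓ T ≤ 1
change≤1 ℓ leaf         = z≤n
change≤1 S (node S _ _) = z≤n
change≤1 S (node P _ _) = ≤-refl
change≤1 P (node S _ _) = ≤-refl
change≤1 P (node P _ _) = z≤n

altsUnder : Label → SPTree → ℕ
altsUnder ℓ T = alts T + change ℓ T

altsUnder-same : ∀ ℓ l r → altsUnder ℓ (node ℓ l r) ≡ alts (node ℓ l r)
altsUnder-same ℓ l r = trans (cong (alts (node ℓ l r) +_) (change-same ℓ)) (+-identityʳ _)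

uniform⇒alts≡0 : ∀ {ℓ T} → Uniform ℓ T → alts T ≡ 0
uniform⇒altsUnder≡0 : ∀ {ℓ T} → Uniform ℓ T → altsUnder ℓ T ≡ 0

uniform⇒alts≡0 leaf = refl
uniform⇒alts≡0 (node ul ur) = cong₂ _⊔_ (uniform⇒altsUnder≡0 ul) (uniform⇒altsUnder≡0 ur)

uniform⇒altsUnder≡0 leaf = refl
uniform⇒altsUnder≡0 {ℓ} u@(node {l} {r} _ _) = trans (altsUnder-same ℓ l r) (uniform⇒alts≡0 u)

layered⇒altsUnder≤1 : ∀ {ℓ T} → Layered ℓ T → altsUnder ℓ T ≤ 1
layered⇒altsUnder≤1 {ℓ} {T} (block u) =
  subst (_≤ 1) (cong (_+ change ℓ T) (sym (uniform⇒alts≡0 u))) (change≤1 ℓ T)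
layered⇒altsUnder≤1 {ℓ} (node {l} {r} Ll Lr) =
  subst (_≤ 1) (sym (altsUnder-same ℓ l r)) (⊔-lub (layered⇒altsUnder≤1 Ll) (layered⇒altsUnder≤1 Lr))

layered⇒alts≤1 : ∀ {ℓ T} → Layered ℓ T → alts T ≤ 1
layered⇒alts≤1 {T = T} L = m+n≤o⇒m≤o (alts T) (layered⇒altsUnder≤1 L)

altsUnder≤0⇒uniform : ∀ ℓ T → altsUnder ℓ T ≤ 0 → Uniform ℓ T
altsUnder≤0⇒uniform ℓ leaf _ = leaf
altsUnder≤0⇒uniform ℓ (node ℓ′ l r) h with label-view ℓ ℓ′
altsUnder≤0⇒uniform ℓ (node .ℓ l r) h | same =
  node (altsUnder≤0⇒uniform ℓ l (m⊔n≤o⇒m≤o _ _ h′)) (altsUnder≤0⇒uniform ℓ r (m⊔n≤o⇒n≤o _ _ h′))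
  where h′ = subst (_≤ 0) (altsUnder-same ℓ l r) h
altsUnder≤0⇒uniform ℓ (node .(other ℓ) l r) h | flipped =
  contradiction (subst (_≤ 0) (change-other ℓ) (m+n≤o⇒n≤o (alts (node (other ℓ) l r)) h)) λ ()

altsUnder≤1⇒layered : ∀ ℓ T → altsUnder ℓ T ≤ 1 → Layered ℓ T
altsUnder≤1⇒layered ℓ leaf _ = block leaf
altsUnder≤1⇒layered ℓ (node ℓ′ l r) h with label-view ℓ ℓ′
altsUnder≤1⇒layered ℓ (node .ℓ l r) h | same =
  node (altsUnder≤1⇒layered ℓ l (m⊔n≤o⇒m≤o _ _ h′)) (altsUnder≤1⇒layered ℓ r (m⊔n≤o⇒n≤o _ _ h′))
  where h′ = subst (_≤ 1) (altsUnder-same ℓ l r) h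
altsUnder≤1⇒layered ℓ (node .(other ℓ) l r) h | flipped =
  block (altsUnder≤0⇒uniform (other ℓ) T h′)
  where T = node (other ℓ) l r
        h′ : altsUnder (other ℓ) T ≤ 0
        h′ = subst (_≤ 0) (sym (altsUnder-same (other ℓ) l r))
                   (+-cancelʳ-≤ 1 (alts T) 0 (subst (λ c → alts T + c ≤ 1) (change-other ℓ) h))

alts≤1⇒layered : ∀ T → alts T ≤ 1 → Layered S T ⊎ Layered P T
alts≤1⇒layered leaf         _ = inj₂ (block leaf)
alts≤1⇒layered (node S l r) h = inj₁ (altsUnder≤1⇒layered S _ (subst (_≤ 1) (sym (altsUnder-same S l r)) h))
alts≤1⇒layered (node P l r) h = inj₂ (altsUnder≤1⇒layered P _ (subst (_≤ 1) (sym (altsUnder-same P l r)) h))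

¬contains⇒uniform : ∀ T → ¬ Contains P T → Uniform S T
¬contains⇒uniform leaf         _  = leaf
¬contains⇒uniform (node S l r) ¬c = node (¬contains⇒uniform l (¬c ∘ left)) (¬contains⇒uniform r (¬c ∘ right))
¬contains⇒uniform (node P l r) ¬c = ⊥-elim (¬c here)

¬seriesOverParallel⇒layered : ∀ T → ¬ SeriesOverParallel T → Layered P T
¬seriesOverParallel⇒layered leaf _ = block leaf
¬seriesOverParallel⇒layered (node S l r) ¬h =
  block (node (¬contains⇒uniform l (λ c → ¬h (here (inj₁ c)))) (¬contains⇒uniform r (λ c → ¬h (here (inj₂ c)))))
¬seriesOverParallel⇒layered (node P l r) ¬h =
  node (¬seriesOverParallel⇒layered l (¬h ∘ left)) (¬seriesOverParallel⇒layered r (¬h ∘ right))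

-- Branch vertices

parallel-or-branch : ∀ {T H} → Decomp T H → Contains P T →
                     BranchVertex H ⊎ (TwoEdgesAt H (src H) × TwoEdgesAt H (snk H))
series-branch : ∀ {l r H} → Decomp (node S l r) H → Contains P l ⊎ Contains P r → BranchVertex H

parallel-or-branch D@(serD _ _ _) (left c)  = inj₁ (series-branch D (inj₁ c))
parallel-or-branch D@(serD _ _ _) (right c) = inj₁ (series-branch D (inj₂ c))
parallel-or-branch (parD D₁ D₂ p) _ =
  inj₂ ( twoEdgesAt glue (proj₁ srcs) (proj₂ srcs) (decomp-edgeAtSrc D₁) (decomp-edgeAtSrc D₂)
       , twoEdgesAt glue (proj₁ snks) (proj₂ snks) (decomp-edgeAtSnk D₁) (decomp-edgeAtSnk D₂))
  where open ParallelComp p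

series-branch (serD D₁ D₂ s) (inj₁ c) with parallel-or-branch D₁ c
... | inj₁ b = branchVertex-embed (embed₁ glue) (Series.internal₁ s) b
  where open SeriesComp s
... | inj₂ (_ , two) =
  branch-2+1 glue (Series.junction-internal s (decomp-src≢snk D₁) (decomp-src≢snk D₂))
             refl (sym joint) two (decomp-edgeAtSrc D₂)
  where open SeriesComp s
series-branch (serD D₁ D₂ s) (inj₂ c) with parallel-or-branch D₂ c
... | inj₁ b = branchVertex-embed (embed₂ glue) (Series.internal₂ s) b
  where open SeriesComp s
... | inj₂ (two , _) =
  branch-1+2 glue (Series.junction-internal s (decomp-src≢snk D₁) (decomp-src≢snk D₂))
             refl (sym joint) (decomp-edgeAtSnk D₁) two
  where open SeriesComp s

seriesOverParallel⇒branchVertex : ∀ {T H} → Decomp T H → SeriesOverParallel T → BranchVertex H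
seriesOverParallel⇒branchVertex D@(serD _ _ _) (here c) = series-branch D c
seriesOverParallel⇒branchVertex (serD D₁ _ s) (left h) =
  branchVertex-embed (embed₁ (SeriesComp.glue s)) (Series.internal₁ s) (seriesOverParallel⇒branchVertex D₁ h)
seriesOverParallel⇒branchVertex (serD _ D₂ s) (right h) =
  branchVertex-embed (embed₂ (SeriesComp.glue s)) (Series.internal₂ s) (seriesOverParallel⇒branchVertex D₂ h)
seriesOverParallel⇒branchVertex (parD D₁ _ p) (left h) =
  branchVertex-embed (embed₁ (ParallelComp.glue p)) (Parallel.internal₁ p) (seriesOverParallel⇒branchVertex D₁ h)
seriesOverParallel⇒branchVertex (parD _ D₂ p) (right h) =
  branchVertex-embed (embed₂ (ParallelComp.glue p)) (Parallel.internal₂ p) (seriesOverParallel⇒branchVertex D₂ h)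

module _ {k G} (M : IsKMelon k G) where
  open IsKMelon M

  private
    incident-step : ∀ {e v i a} → Inverse.from edges e ≡ (i , a) → Incident G e v →
                    path i (inject₁ a) ≡ v ⊎ path i (suc a) ≡ v
    incident-step {e} {i = i} {a} e↦ia e∋v =
      ∈ᵉ-resp-SameEdge (SameEdge-sym (subst (λ e → SameEdge (ends G e) _) to-from (edgeEnds i a))) e∋v
      where to-from : Inverse.to edges (i , a) ≡ e
            to-from = trans (cong (Inverse.to edges) (sym e↦ia)) (Inverse.strictlyInverseˡ edges e)

    same-step : (pos : ∀ {n} → Fin n → Fin (suc n)) → (∀ {n} → Injective _≡_ _≡_ (pos {n})) →
                ∀ {v e e′ i i′ a a′} → Internal G v →
                Inverse.from edges e ≡ (i , a) → Inverse.from edges e′ ≡ (i′ , a′) →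
                path i (pos a) ≡ v → path i′ (pos a′) ≡ v → e ≡ e′
    same-step pos pos-injective {i = i} {i′} {a} {a′} (v≢s , v≢t) e↦ia e′↦ia′ ia∋v ia′∋v
      with disjoint i i′ (pos a) (pos a′) (trans ia∋v (sym ia′∋v))
    ... | inj₁ refl = from-injective edges (trans e↦ia (trans (cong (i ,_) a≡a′) (sym e′↦ia′)))
      where a≡a′ = pos-injective (pathInj i (trans ia∋v (sym ia′∋v)))
    ... | inj₂ (inj₁ t) = ⊥-elim (v≢s (trans (sym ia∋v) t))
    ... | inj₂ (inj₂ t) = ⊥-elim (v≢t (trans (sym ia∋v) t))

    no-three-steps : ∀ {v e₁ e₂ e₃} → Internal G v → e₁ ≢ e₂ → e₁ ≢ e₃ → e₂ ≢ e₃ →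
                     Incident G e₁ v → Incident G e₂ v → Incident G e₃ v → ⊥
    no-three-steps int e₁≢e₂ e₁≢e₃ e₂≢e₃ at₁ at₂ at₃
      with incident-step refl at₁ | incident-step refl at₂ | incident-step refl at₃
    ... | inj₁ p₁ | inj₁ p₂ | _       = e₁≢e₂ (same-step inject₁ inject₁-injective int refl refl p₁ p₂)
    ... | inj₂ p₁ | inj₂ p₂ | _       = e₁≢e₂ (same-step suc suc-injective int refl refl p₁ p₂)
    ... | inj₁ p₁ | inj₂ _  | inj₁ p₃ = e₁≢e₃ (same-step inject₁ inject₁-injective int refl refl p₁ p₃)
    ... | inj₁ _  | inj₂ p₂ | inj₂ p₃ = e₂≢e₃ (same-step suc suc-injective int refl refl p₂ p₃)
    ... | inj₂ _  | inj₁ p₂ | inj₁ p₃ = e₂≢e₃ (same-step inject₁ inject₁-injective int refl refl p₂ p₃)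
    ... | inj₂ p₁ | inj₁ _  | inj₂ p₃ = e₁≢e₃ (same-step suc suc-injective int refl refl p₁ p₃)

  melon-¬branchVertex : ¬ BranchVertex G
  melon-¬branchVertex b = no-three-steps internal e₁≢e₂ e₁≢e₃ e₂≢e₃ at₁ at₂ at₃
    where open BranchVertex b

melon⇒altAtMost1 : (G : TTG) → IsMelon G → AltAtMost 1 G
melon⇒altAtMost1 G (k , M) T D =
  layered⇒alts≤1 (¬seriesOverParallel⇒layered T (melon-¬branchVertex M ∘ seriesOverParallel⇒branchVertex D))

-- Paths between the terminals

-- The shared vertex (the last of u, the first of w) occurs once.
concatSeq : ∀ {X : Set} m {n} → (Fin (suc m) → X) → (Fin (suc n) → X) → Fin (suc (m + n)) → X
concatSeq zero    u w         = w
concatSeq (suc m) u w zero    = u zero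
concatSeq (suc m) u w (suc a) = concatSeq m (u ∘ suc) w a

module _ {X : Set} where

  concatSeq-↑ˡ : ∀ m {n} {u : Fin (suc m) → X} {w : Fin (suc n) → X} → u (fromℕ m) ≡ w zero →
                 ∀ b → concatSeq m u w (b ↑ˡ n) ≡ u b
  concatSeq-↑ˡ zero    u≡w zero    = sym u≡w
  concatSeq-↑ˡ (suc m) u≡w zero    = refl
  concatSeq-↑ˡ (suc m) u≡w (suc b) = concatSeq-↑ˡ m u≡w b

  concatSeq-inject₁-↑ˡ : ∀ m {n} {u : Fin (suc m) → X} {w : Fin (suc n) → X} (a : Fin m) →
                         concatSeq m u w (inject₁ (a ↑ˡ n)) ≡ u (inject₁ a)
  concatSeq-inject₁-↑ˡ (suc m) zero    = refl
  concatSeq-inject₁-↑ˡ (suc m) (suc a) = concatSeq-inject₁-↑ˡ m a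

  concatSeq-suc-↑ʳ : ∀ m {n} {u : Fin (suc m) → X} {w : Fin (suc n) → X} (c : Fin n) →
                     concatSeq m u w (suc m ↑ʳ c) ≡ w (suc c)
  concatSeq-suc-↑ʳ zero    c = refl
  concatSeq-suc-↑ʳ (suc m) c = concatSeq-suc-↑ʳ m c

  concatSeq-inject₁-↑ʳ : ∀ m {n} {u : Fin (suc m) → X} {w : Fin (suc n) → X} (c : Fin n) →
                         concatSeq m u w (inject₁ (m ↑ʳ c)) ≡ w (inject₁ c)
  concatSeq-inject₁-↑ʳ zero    c = refl
  concatSeq-inject₁-↑ʳ (suc m) c = concatSeq-inject₁-↑ʳ m c

  concatSeq-fromℕ : ∀ m {n} {u : Fin (suc m) → X} {w : Fin (suc n) → X} →
                    concatSeq m u w (fromℕ (m + n)) ≡ w (fromℕ n)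
  concatSeq-fromℕ zero    = refl
  concatSeq-fromℕ (suc m) = concatSeq-fromℕ m

  module _ (m : ℕ) {n} {u : Fin (suc m) → X} {w : Fin (suc n) → X} (u≡w : u (fromℕ m) ≡ w zero) where

    private
      atˡ : ∀ b → concatSeq m u w (b ↑ˡ n) ≡ u b
      atˡ = concatSeq-↑ˡ m u≡w

      atʳ : ∀ c → concatSeq m u w (suc m ↑ʳ c) ≡ w (suc c)
      atʳ = concatSeq-suc-↑ʳ m

    concatSeq-injective : Injective _≡_ _≡_ u → Injective _≡_ _≡_ w → (∀ b c → u b ≡ w c → c ≡ zero) →
                          Injective _≡_ _≡_ (concatSeq m u w)
    concatSeq-injective u-inj w-inj meet {a} {a′} eq with ↑-view (suc m) n a | ↑-view (suc m) n a′
    ... | inj₁ (b , refl) | inj₁ (b′ , refl) = cong (_↑ˡ n) (u-inj (trans (sym (atˡ b)) (trans eq (atˡ b′))))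
    ... | inj₁ (b , refl) | inj₂ (c , refl) =
      contradiction (meet b (suc c) (trans (sym (atˡ b)) (trans eq (atʳ c)))) λ ()
    ... | inj₂ (c , refl) | inj₁ (b , refl) =
      contradiction (meet b (suc c) (trans (sym (atˡ b)) (trans (sym eq) (atʳ c)))) λ ()
    ... | inj₂ (c , refl) | inj₂ (c′ , refl) =
      cong (suc m ↑ʳ_) (suc-injective (w-inj (trans (sym (atʳ c)) (trans eq (atʳ c′)))))

    concatSeq-covers : ∀ {x} → (∃ λ b → u b ≡ x) ⊎ (∃ λ c → w c ≡ x) → ∃ λ a → concatSeq m u w a ≡ x
    concatSeq-covers (inj₁ (b , q))     = b ↑ˡ n , trans (atˡ b) q
    concatSeq-covers (inj₂ (zero , q))  = fromℕ m ↑ˡ n , trans (atˡ (fromℕ m)) (trans u≡w q)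
    concatSeq-covers (inj₂ (suc c , q)) = suc m ↑ʳ c , trans (atʳ c) q

record STMultiPath (H : TTG) : Set where
  field
    len             : ℕ
    vert            : Fin (suc len) → Fin (nV H)
    vert-injective  : Injective _≡_ _≡_ vert
    vert-surjective : ∀ v → ∃ λ a → vert a ≡ v
    vert-start      : vert zero ≡ src H
    vert-end        : vert (fromℕ len) ≡ snk H
    step            : Fin (nE H) → Fin len
    step-ends       : ∀ e → SameEdge (ends H e) (vert (inject₁ (step e)) , vert (suc (step e)))
    step-surjective : ∀ a → ∃ λ e → step e ≡ a

  section : Fin len → Fin (nE H)
  section a = proj₁ (step-surjective a)

  section-ends : ∀ a → SameEdge (ends H (section a)) (vert (inject₁ a) , vert (suc a))
  section-ends a = subst (λ b → SameEdge (ends H (section a)) (vert (inject₁ b) , vert (suc b)))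
                         (proj₂ (step-surjective a)) (step-ends (section a))

  1≤len : src H ≢ snk H → 1 ≤ len
  1≤len src≢snk = n≢0⇒n>0 λ len≡0 →
    src≢snk (trans (sym vert-start) (trans (cong vert (zero≡fromℕ len≡0)) vert-end))
    where zero≡fromℕ : ∀ {n} → n ≡ 0 → zero ≡ fromℕ n
          zero≡fromℕ refl = refl

STMultiPath⇒IsMultiPath : ∀ {H} → STMultiPath H → IsMultiPath H
STMultiPath⇒IsMultiPath M = record
  { len = len ; vert = vert ; vertInj = vert-injective ; vertSurj = vert-surjective
  ; edgeOn = λ e → step e , step-ends e
  ; stepHasEdge = λ a → section a , section-ends a }
  where open STMultiPath M

SimpleSTPath : TTG → Set
SimpleSTPath H = Σ (STMultiPath H) λ M → Injective _≡_ _≡_ (STMultiPath.step M)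

record IsDipole (H : TTG) : Set where
  field
    terminal : ∀ v → Terminal H v
    parallel : ∀ e → SameEdge (ends H e) (src H , snk H)

singleEdge⇒dipole : ∀ {H} → IsSingleEdge H → IsDipole H
singleEdge⇒dipole (_ , _ , terminal , parallel) = record { terminal = terminal ; parallel = parallel }

parallel-dipole : ∀ {G₁ G₂ G} → ParallelComp G₁ G₂ G → IsDipole G₁ → IsDipole G₂ → IsDipole G
parallel-dipole {G = G} p B₁ B₂ = record { terminal = terminal ; parallel = parallel }
  where
  open ParallelComp p
  open Glue glue
  module B₁ = IsDipole B₁
  module B₂ = IsDipole B₂
  terminal : ∀ v → Terminal G v
  terminal v with cover v
  ... | inj₁ (u , refl) = Parallel.terminal₁ p (B₁.terminal u)
  ... | inj₂ (u , refl) = Parallel.terminal₂ p (B₂.terminal u)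
  parallel : ∀ e → SameEdge (ends G e) (src G , snk G)
  parallel e with edge-view glue e
  ... | inj₁ (x , refl) = SameEdge-≡ (emap-SameEdge (embed₁ glue) (B₁.parallel x)) (proj₁ srcs) (proj₁ snks)
  ... | inj₂ (x , refl) = SameEdge-≡ (emap-SameEdge (embed₂ glue) (B₂.parallel x)) (proj₂ srcs) (proj₂ snks)

uniformP⇒dipole : ∀ {T H} → Uniform P T → Decomp T H → IsDipole H
uniformP⇒dipole leaf         (leafD h)        = singleEdge⇒dipole h
uniformP⇒dipole (node ul ur) (parD D₁ D₂ p) = parallel-dipole p (uniformP⇒dipole ul D₁) (uniformP⇒dipole ur D₂)

dipole⇒STMultiPath : ∀ {H} → src H ≢ snk H → Fin (nE H) → IsDipole H → STMultiPath H
dipole⇒STMultiPath {H} src≢snk e₀ B = record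
  { len = 1 ; vert = vert ; vert-injective = vert-injective ; vert-surjective = vert-surjective
  ; vert-start = refl ; vert-end = refl
  ; step = λ _ → zero ; step-ends = parallel ; step-surjective = λ { zero → e₀ , refl } }
  where
  open IsDipole B
  vert : Fin 2 → Fin (nV H)
  vert zero    = src H
  vert (suc _) = snk H
  vert-injective : Injective _≡_ _≡_ vert
  vert-injective {zero}     {zero}     _  = refl
  vert-injective {zero}     {suc zero} eq = ⊥-elim (src≢snk eq)
  vert-injective {suc zero} {zero}     eq = ⊥-elim (src≢snk (sym eq))
  vert-injective {suc zero} {suc zero} _  = refl
  vert-surjective : ∀ v → ∃ λ a → vert a ≡ v
  vert-surjective v with terminal v
  ... | inj₁ q = zero , sym q
  ... | inj₂ q = suc zero , sym q

singleEdge⇒simple : ∀ {H} → IsSingleEdge H → SimpleSTPath H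
singleEdge⇒simple {H} h@(src≢snk , nE≡1 , _) =
  dipole⇒STMultiPath src≢snk (subst Fin (sym nE≡1) zero) (singleEdge⇒dipole h) , λ _ → one-edge _ _
  where one-edge : (e e′ : Fin (nE H)) → e ≡ e′
        one-edge = subst (λ n → (e e′ : Fin n) → e ≡ e′) (sym nE≡1) λ { zero zero → refl }

module SeriesPath {G₁ G₂ G} (s : SeriesComp G₁ G₂ G) (M₁ : STMultiPath G₁) (M₂ : STMultiPath G₂) where
  open SeriesComp s
  open Glue glue
  module M₁ = STMultiPath M₁
  module M₂ = STMultiPath M₂
  L₁ = M₁.len
  L₂ = M₂.len

  junction : f₁ (M₁.vert (fromℕ L₁)) ≡ f₂ (M₂.vert zero)
  junction = trans (cong f₁ M₁.vert-end) (trans joint (cong f₂ (sym M₂.vert-start)))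

  vert : Fin (suc (L₁ + L₂)) → Fin (nV G)
  vert = concatSeq L₁ (f₁ ∘ M₁.vert) (f₂ ∘ M₂.vert)

  step : Fin (nE G) → Fin (L₁ + L₂)
  step e = join L₁ L₂ (Sum.map M₁.step M₂.step (Inverse.from edges e))

  step-emap₁ : ∀ x → step (emap (embed₁ glue) x) ≡ M₁.step x ↑ˡ L₂
  step-emap₁ x = cong (join L₁ L₂ ∘ Sum.map M₁.step M₂.step) (Inverse.strictlyInverseʳ edges (inj₁ x))

  step-emap₂ : ∀ x → step (emap (embed₂ glue) x) ≡ L₁ ↑ʳ M₂.step x
  step-emap₂ x = cong (join L₁ L₂ ∘ Sum.map M₁.step M₂.step) (Inverse.strictlyInverseʳ edges (inj₂ x))

  step-ends : ∀ e → SameEdge (ends G e) (vert (inject₁ (step e)) , vert (suc (step e)))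
  step-ends e with edge-view glue e
  ... | inj₁ (x , refl) rewrite step-emap₁ x =
    SameEdge-≡ (emap-SameEdge (embed₁ glue) (M₁.step-ends x))
               (sym (concatSeq-inject₁-↑ˡ L₁ (M₁.step x))) (sym (concatSeq-↑ˡ L₁ junction (suc (M₁.step x))))
  ... | inj₂ (x , refl) rewrite step-emap₂ x =
    SameEdge-≡ (emap-SameEdge (embed₂ glue) (M₂.step-ends x))
               (sym (concatSeq-inject₁-↑ʳ L₁ (M₂.step x))) (sym (concatSeq-suc-↑ʳ L₁ (M₂.step x)))

  step-surjective : ∀ a → ∃ λ e → step e ≡ a
  step-surjective a with ↑-view L₁ L₂ a
  ... | inj₁ (a₁ , refl) = let (x , q) = M₁.step-surjective a₁ in
    emap (embed₁ glue) x , trans (step-emap₁ x) (cong (_↑ˡ L₂) q)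
  ... | inj₂ (a₂ , refl) = let (x , q) = M₂.step-surjective a₂ in
    emap (embed₂ glue) x , trans (step-emap₂ x) (cong (L₁ ↑ʳ_) q)

  path : STMultiPath G
  path = record
    { len = L₁ + L₂
    ; vert = vert
    ; vert-injective = concatSeq-injective L₁ junction (M₁.vert-injective ∘ inj₁f) (M₂.vert-injective ∘ inj₂f)
        λ b c eq → M₂.vert-injective (trans (proj₂ (meet _ _ eq)) (sym M₂.vert-start))
    ; vert-surjective = λ v → concatSeq-covers L₁ junction (Sum.map (lift₁ v) (lift₂ v) (cover v))
    ; vert-start = trans (concatSeq-↑ˡ L₁ junction zero) (trans (cong f₁ M₁.vert-start) (sym newSrc))
    ; vert-end = trans (concatSeq-fromℕ L₁) (trans (cong f₂ M₂.vert-end) (sym newSnk))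
    ; step = step ; step-ends = step-ends ; step-surjective = step-surjective }
    where
    lift₁ : ∀ v → (∃ λ u → f₁ u ≡ v) → ∃ λ b → f₁ (M₁.vert b) ≡ v
    lift₁ v (u , q) = let (b , r) = M₁.vert-surjective u in b , trans (cong f₁ r) q
    lift₂ : ∀ v → (∃ λ u → f₂ u ≡ v) → ∃ λ c → f₂ (M₂.vert c) ≡ v
    lift₂ v (u , q) = let (c , r) = M₂.vert-surjective u in c , trans (cong f₂ r) q

  step-injective : Injective _≡_ _≡_ M₁.step → Injective _≡_ _≡_ M₂.step → Injective _≡_ _≡_ step
  step-injective step₁-inj step₂-inj eq =
    from-injective edges (⊎-map-injective step₁-inj step₂-inj (from-injective (+↔⊎ {L₁} {L₂}) eq))

series-simple : ∀ {G₁ G₂ G} → SeriesComp G₁ G₂ G → SimpleSTPath G₁ → SimpleSTPath G₂ → SimpleSTPath G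
series-simple s (M₁ , step₁-inj) (M₂ , step₂-inj) =
  SeriesPath.path s M₁ M₂ , SeriesPath.step-injective s M₁ M₂ step₁-inj step₂-inj

-- Melons

simple⇒1-melon : ∀ {H} → src H ≢ snk H → SimpleSTPath H → IsKMelon 1 H
simple⇒1-melon {H} src≢snk (M , step-injective) = record
  { distinct = src≢snk
  ; len = λ _ → len ; len≥1 = λ _ → 1≤len src≢snk
  ; path = λ _ → vert ; pathInj = λ _ → vert-injective
  ; start = λ _ → vert-start ; end = λ _ → vert-end
  ; disjoint = λ { zero zero _ _ _ → inj₁ refl }
  ; cover = λ v → zero , vert-surjective v
  ; edges = ↔-trans one-strand steps↔edges
  ; edgeEnds = λ { zero → section-ends } }
  where
  open STMultiPath M
  one-strand : (Fin 1 × Fin len) ↔ Fin len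
  one-strand = mk↔ₛ′ proj₂ (zero ,_) (λ _ → refl) λ { (zero , _) → refl }
  steps↔edges : Fin len ↔ Fin (nE H)
  steps↔edges = mk↔ₛ′ section step (λ e → step-injective (proj₂ (step-surjective (step e))))
                                   (λ a → proj₂ (step-surjective a))

module ParallelMelon {G₁ G₂ G k₁ k₂} (p : ParallelComp G₁ G₂ G)
                     (M₁ : IsKMelon k₁ G₁) (M₂ : IsKMelon k₂ G₂) where
  open ParallelComp p
  open Glue glue hiding (cover)
  module M₁ = IsKMelon M₁
  module M₂ = IsKMelon M₂

  Strand : Set
  Strand = Fin k₁ ⊎ Fin k₂

  len : Strand → ℕ
  len = [ M₁.len , M₂.len ]′

  path : (s : Strand) → Fin (suc (len s)) → Fin (nV G)
  path (inj₁ j) = f₁ ∘ M₁.path j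
  path (inj₂ j) = f₂ ∘ M₂.path j

  len≥1 : ∀ s → 1 ≤ len s
  len≥1 (inj₁ j) = M₁.len≥1 j
  len≥1 (inj₂ j) = M₂.len≥1 j

  path-injective : ∀ s → Injective _≡_ _≡_ (path s)
  path-injective (inj₁ j) = M₁.pathInj j ∘ inj₁f
  path-injective (inj₂ j) = M₂.pathInj j ∘ inj₂f

  start : ∀ s → path s zero ≡ src G
  start (inj₁ j) = trans (cong f₁ (M₁.start j)) (proj₁ srcs)
  start (inj₂ j) = trans (cong f₂ (M₂.start j)) (proj₂ srcs)

  end : ∀ s → path s (fromℕ (len s)) ≡ snk G
  end (inj₁ j) = trans (cong f₁ (M₁.end j)) (proj₁ snks)
  end (inj₂ j) = trans (cong f₂ (M₂.end j)) (proj₂ snks)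

  disjoint : ∀ s s′ a b → path s a ≡ path s′ b → s ≡ s′ ⊎ Terminal G (path s a)
  disjoint (inj₁ j) (inj₁ j′) a b eq = Sum.map (cong inj₁) (Parallel.terminal₁ p) (M₁.disjoint j j′ a b (inj₁f eq))
  disjoint (inj₂ j) (inj₂ j′) a b eq = Sum.map (cong inj₂) (Parallel.terminal₂ p) (M₂.disjoint j j′ a b (inj₂f eq))
  disjoint (inj₁ j) (inj₂ j′) a b eq = inj₂ (Parallel.terminal₁ p (Sum.map proj₁ proj₁ (meet _ _ eq)))
  disjoint (inj₂ j) (inj₁ j′) a b eq = inj₂ (Parallel.terminal₂ p (Sum.map proj₂ proj₂ (meet _ _ (sym eq))))

  cover : ∀ v → ∃ λ s → ∃ λ a → path s a ≡ v
  cover v with Glue.cover glue v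
  ... | inj₁ (u , refl) = let (j , a , q) = M₁.cover u in inj₁ j , a , cong f₁ q
  ... | inj₂ (u , refl) = let (j , a , q) = M₂.cover u in inj₂ j , a , cong f₂ q

  edges′ : Σ Strand (Fin ∘ len) ↔ Fin (nE G)
  edges′ = ↔-trans Σ-distribʳ-⊎ (↔-trans (M₁.edges ⊎-↔ M₂.edges) edges)

  edgeEnds : ∀ s a → SameEdge (ends G (Inverse.to edges′ (s , a))) (path s (inject₁ a) , path s (suc a))
  edgeEnds (inj₁ j) a = emap-SameEdge (embed₁ glue) (M₁.edgeEnds j a)
  edgeEnds (inj₂ j) a = emap-SameEdge (embed₂ glue) (M₂.edgeEnds j a)

  melon : IsKMelon (k₁ + k₂) G
  melon = record
    { distinct = Parallel.src≢snk p M₁.distinct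
    ; len = len ∘ splitAt k₁
    ; len≥1 = len≥1 ∘ splitAt k₁
    ; path = path ∘ splitAt k₁
    ; pathInj = path-injective ∘ splitAt k₁
    ; start = start ∘ splitAt k₁
    ; end = end ∘ splitAt k₁
    ; disjoint = λ i j a b eq → Sum.map₁ (to-injective +↔⊎) (disjoint (splitAt k₁ i) (splitAt k₁ j) a b eq)
    ; cover = λ v → let (s , a , q) = cover v in join k₁ k₂ s , renumber s a q
    ; edges = ↔-trans (Σ-↔ +↔⊎ ↔-refl) edges′
    ; edgeEnds = edgeEnds ∘ splitAt k₁ }
    where
    renumber : ∀ {v} s a → path s a ≡ v → ∃ λ a′ → path (splitAt k₁ (join k₁ k₂ s)) a′ ≡ v
    renumber s a q rewrite splitAt-join k₁ k₂ s = a , q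

-- Graphs of a layered decomposition

layeredS⇒STMultiPath : ∀ {T H} → Layered S T → Decomp T H → STMultiPath H
layeredS⇒STMultiPath (block u) D =
  dipole⇒STMultiPath (decomp-src≢snk D) (proj₁ (decomp-edgeAtSrc D)) (uniformP⇒dipole u D)
layeredS⇒STMultiPath (node Ll Lr) (serD D₁ D₂ s) =
  SeriesPath.path s (layeredS⇒STMultiPath Ll D₁) (layeredS⇒STMultiPath Lr D₂)

uniformS⇒simple : ∀ {T H} → Uniform S T → Decomp T H → SimpleSTPath H
uniformS⇒simple leaf         (leafD h)      = singleEdge⇒simple h
uniformS⇒simple (node ul ur) (serD D₁ D₂ s) = series-simple s (uniformS⇒simple ul D₁) (uniformS⇒simple ur D₂)

layeredP⇒melon : ∀ {T H} → Layered P T → Decomp T H → ∃ λ k → 1 ≤ k × IsKMelon k H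
layeredP⇒melon (block u) D = 1 , ≤-refl , simple⇒1-melon (decomp-src≢snk D) (uniformS⇒simple u D)
layeredP⇒melon (node Ll Lr) (parD D₁ D₂ p) with layeredP⇒melon Ll D₁ | layeredP⇒melon Lr D₂
... | k₁ , 1≤k₁ , M₁ | k₂ , _ , M₂ = k₁ + k₂ , ≤-trans 1≤k₁ (m≤m+n k₁ k₂) , ParallelMelon.melon p M₁ M₂

altAtMost1⇒melon⊎multiPath : (G : TTG) → IsSeriesParallel G → AltAtMost 1 G →
                             (∃ λ k → 1 ≤ k × IsKMelon k G) ⊎ IsMultiPath G
altAtMost1⇒melon⊎multiPath G (T , D) alt≤1 with alts≤1⇒layered T (alt≤1 T D)
... | inj₁ layeredS = inj₂ (STMultiPath⇒IsMultiPath (layeredS⇒STMultiPath layeredS D))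
... | inj₂ layeredP = inj₁ (layeredP⇒melon layeredP D)

lemma17 : ((G : TTG) → IsMelon G → AltAtMost 1 G)
          × ((G : TTG) → IsSeriesParallel G → AltAtMost 1 G →
             (∃ λ k → 1 ≤ k × IsKMelon k G) ⊎ IsMultiPath G)
lemma17 = melon⇒altAtMost1 , altAtMost1⇒melon⊎multiPath
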